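{- Let $n\ge2$, $t\in\mathbb Z_{\ge0}$ and $\mathbf N=(t,0,\dots,0,-t)\in\mathbb Z^{n+1}$. Then $|\mathcal S^+_n(\mathbf N)|=J_{n-1,t}$, the number of permutations of $\{1,\dots,n-1\}$ with at most $t$ inversions. In particular, for $t\ge\binom{n-1}2$, $|\mathcal S^+_n(\mathbf N)|=(n-1)!$.
   Context: $K_n(\mathbf V)$, for $\mathbf V=(V_0,\dots,V_n)\in\mathbb Z^{n+1}$ with $V_n=-\sum_{i<n}V_i$, is the number of integer vectors $(f_{ij})_{0\le i<j\le n}$ with $f_{ij}\ge0$ and $\sum_{j>i}f_{ij}-\sum_{k<i}f_{ki}=V_i$ for all $i$. For a weak composition $\mathbf j=(j_0,\dots,j_{n-1})$ of $\binom n2$, $K_n(\mathbf j-\boldsymbol\delta)$ means $K_n(j_0-(n-1),j_1-(n-2),\dots,j_{n-1}-0,0)$. $\mathcal S^+_n(\mathbf N)$ is the set of weak compositions $\mathbf j$ of $\binom n2$ with $n$ parts such that $\binom{N_0+n-1}{j_0}\binom{N_1+n-2}{j_1}\cdots\binom{N_{n-1}}{j_{n-1}}\cdot K_n(\mathbf j-\boldsymbol\delta)>0$. An inversion of a permutation $w_1\cdots w_m$ is a pair $i<j$ with $w_i>w_j$. -}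

module Defs where

open import Data.Bool using (Bool; true; false; _∧_; if_then_else_)
open import Data.Nat as ℕ using (ℕ; zero; suc; _∸_)
open import Data.Nat.Combinatorics using (_C_)
open import Data.Integer as ℤ using (ℤ; +_; -[1+_]; ∣_∣)
open import Data.Fin using (Fin; toℕ)
open import Data.Nat.ListAction using (sum)
open import Data.List as L using (List; []; _∷_; [_]; concatMap; upTo; filterᵇ; length)
open import Data.Vec as V using (Vec; []; _∷_; lookup; tabulate; toList; _∷ʳ_)
open import Relation.Nullary.Decidable using (⌊_⌋)

vecsOver : {A : Set} → List A → (m : ℕ) → List (Vec A m)
vecsOver xs zero    = [ [] ]
vecsOver xs (suc m) = concatMap (λ x → L.map (x ∷_) (vecsOver xs m)) xs

natVecs : (m B : ℕ) → List (Vec ℕ m)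
natVecs m B = vecsOver (upTo (suc B)) m

sumℤ : {m : ℕ} → Vec ℤ m → ℤ
sumℤ = V.foldr _ ℤ._+_ (+ 0)

prodℤ : {m : ℕ} → Vec ℤ m → ℤ
prodℤ = V.foldr _ ℤ._*_ (+ 1)

-- A flow f = (f_ij)_{0≤i<j≤n} is stored as an (n+1)×(n+1) matrix of
-- naturals whose entries with j ≤ i are required to be 0 (so this is a
-- bijective encoding of the vectors (f_ij)_{i<j} with f_ij ≥ 0).

Mat : ℕ → Set
Mat N = Vec (Vec ℕ N) N

entry : {N : ℕ} → Mat N → Fin N → Fin N → ℕ
entry f i j = lookup (lookup f i) j

outflow : {N : ℕ} → Mat N → Fin N → ℕ
outflow f i = sum (toList (lookup f i))

inflow : {N : ℕ} → Mat N → Fin N → ℕ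
inflow {N} f i = sum (toList (tabulate {n = N} (λ k → entry f k i)))

allB : {N : ℕ} → (Fin N → Bool) → Bool
allB {N} p = V.foldr _ _∧_ true (tabulate {n = N} p)

upperᵇ : {N : ℕ} → Mat N → Bool
upperᵇ f = allB (λ i → allB (λ j →
  if ⌊ toℕ j ℕ.≤? toℕ i ⌋ then ⌊ entry f i j ℕ.≟ 0 ⌋ else true))

netᵇ : {N : ℕ} → Vec ℤ N → Mat N → Bool
netᵇ v f = allB (λ i → ⌊ (+ outflow f i) ℤ.- (+ inflow f i) ℤ.≟ lookup v i ⌋)

isFlowᵇ : {N : ℕ} → Vec ℤ N → Mat N → Bool
isFlowᵇ v f = upperᵇ f ∧ netᵇ v f

-- Every flow satisfies f_ij ≤ Σ_k |V_k| (indeed f_ij ≤ outflow(i)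
-- ≤ V_0 + … + V_i by acyclicity), so enumerating the box with this
-- bound counts ALL integer flows.
flowBound : {N : ℕ} → Vec ℤ N → ℕ
flowBound v = V.foldr _ (λ x acc → ∣ x ∣ ℕ.+ acc) 0 v

K : (n : ℕ) → Vec ℤ (suc n) → ℕ
K n v = length (filterᵇ (isFlowᵇ v)
          (vecsOver (natVecs (suc n) (flowBound v)) (suc n)))

-- Binomial coefficient with integer top and natural bottom:
-- binom(a, k) = a(a−1)…(a−k+1)/k!.  For a = −(m+1) < 0 this is
-- (−1)^k binom(m+k, k).
binomℤ : ℤ → ℕ → ℤ
binomℤ (+ m)     k = + (m C k)
binomℤ -[1+ m ]  k = signPow k ℤ.* (+ ((m ℕ.+ k) C k))
  where
  signPow : ℕ → ℤ
  signPow zero    = + 1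
  signPow (suc k) = ℤ.- (signPow k)

jMinusδ : (n : ℕ) → Vec ℕ n → Vec ℤ (suc n)
jMinusδ n j = tabulate (λ i → (+ lookup j i) ℤ.- (+ (n ∸ suc (toℕ i)))) ∷ʳ (+ 0)

isWeakCompᵇ : (n : ℕ) → Vec ℕ n → Bool
isWeakCompᵇ n j = ⌊ V.sum j ℕ.≟ n C 2 ⌋

weight : (n : ℕ) → Vec ℤ (suc n) → Vec ℕ n → ℤ
weight n N j =
  prodℤ (tabulate (λ i →
    binomℤ (lookup N (Data.Fin.inject₁ i) ℤ.+ (+ (n ∸ suc (toℕ i)))) (lookup j i)))
  ℤ.* (+ K n (jMinusδ n j))

-- S⁺_n(N) as an explicit list (every weak composition of binom(n,2) has
-- entries ≤ binom(n,2), so this enumeration is exhaustive and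
-- duplicate-free).
Splus : (n : ℕ) → Vec ℤ (suc n) → List (Vec ℕ n)
Splus n N = filterᵇ (λ j → isWeakCompᵇ n j ∧ ⌊ (+ 0) ℤ.<? weight n N j ⌋)
                    (natVecs n (n C 2))

cardSplus : (n : ℕ) → Vec ℤ (suc n) → ℕ
cardSplus n N = length (Splus n N)

Nvec : (n t : ℕ) → Vec ℤ (suc n)
Nvec n t = tabulate (λ i →
  if ⌊ toℕ i ℕ.≟ 0 ⌋ then + t
  else if ⌊ toℕ i ℕ.≟ n ⌋ then ℤ.- (+ t) else + 0)

allL : {A : Set} → (A → Bool) → List A → Bool
allL p = L.foldr (λ x acc → p x ∧ acc) true

distinctᵇ : List ℕ → Bool
distinctᵇ []       = true
distinctᵇ (x ∷ xs) = allL (λ y → ⌊ x ℕ.≟ y ⌋ Data.Bool.xor true) xs ∧ distinctᵇ xs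

isPermWordᵇ : (m : ℕ) → Vec ℕ m → Bool
isPermWordᵇ m w = allL (λ x → ⌊ 1 ℕ.≤? x ⌋) (toList w) ∧ distinctᵇ (toList w)

perms : (m : ℕ) → List (Vec ℕ m)
perms m = filterᵇ (isPermWordᵇ m) (natVecs m m)

inversions : List ℕ → ℕ
inversions []       = 0
inversions (x ∷ xs) = length (filterᵇ (λ y → ⌊ y ℕ.<? x ⌋) xs) ℕ.+ inversions xs

J : (m t : ℕ) → ℕ
J m t = length (filterᵇ (λ w → ⌊ inversions (toList w) ℕ.≤? t ⌋) (perms m))

-- Write n = m + 1 and j = x ∷ c with c ∈ ℕᵐ. For N = (t, 0, …, 0, −t) the binomial factors of the
-- weight are C(t + m, x) and C(m − 1 − k, c_k), which are nonzero iff x ≤ t + m and c lies under the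
-- staircase (m − 1, …, 1, 0); under these conditions K_n(j − δ) > 0, because vertex 0 can send every
-- other vertex its demand directly. Since Σ j = C(n, 2) determines x from c, the elements of S⁺_n(N)
-- correspond to the c under the staircase that miss at most t of its cells, i.e. (after complementing)
-- to Lehmer codes of weight at most t. Permutations of {1, …, m} with at most t inversions satisfy the
-- same recursion: a first letter of rank r accounts for exactly r inversions. When t ≥ C(m, 2) every
-- Lehmer code counts, which gives m!.

module Submission where

open import Defs
open import Data.Bool using (Bool; true; false; _∧_; _xor_; not; if_then_else_; T)
open import Data.Bool.Properties using (∧-zeroʳ; T-∧; T-≡)
open import Data.Nat using (ℕ; zero; suc; _+_; _*_; _∸_; _≤_; _<_; z≤n; s≤s; _≤?_; _<?_; _≟_; _!)
open import Data.Nat.Properties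
open import Algebra.Properties.CommutativeSemigroup +-commutativeSemigroup
  using () renaming (interchange to +-interchange)
open import Data.Nat.ListAction using (sum)
open import Data.Nat.Combinatorics using (_C_; nC1≡n; nCk+nC[k+1]≡[n+1]C[k+1]; k>n⇒nCk≡0)
open import Data.List using (List; []; _∷_; _++_; length; map; concatMap; applyUpTo; upTo; filterᵇ)
open import Data.List.Properties using (length-++; length-++-sucʳ; length-applyUpTo; map-cong; filter-some)
open import Data.List.Membership.Propositional using (_∈_; _∉_; lose; find)
open import Data.List.Membership.Propositional.Properties
  using (∈-++⁻; ∈-∃++; ∈-map⁺; ∈-map⁻; ∈-concatMap⁺; ∈-concatMap⁻; ∈-applyUpTo⁻; ∈-upTo⁺)
open import Data.List.Relation.Unary.All as All using (All; []; _∷_)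
import Data.List.Relation.Unary.All.Properties as Allₚ
open import Data.List.Relation.Unary.AllPairs using (AllPairs; []; _∷_)
import Data.List.Relation.Unary.AllPairs.Properties as AllPairsₚ
open import Data.List.Relation.Unary.Any as Any using (here; there)
open import Data.List.Relation.Unary.Unique.Propositional using (Unique)
import Data.List.Relation.Unary.Unique.Propositional.Properties as Uniqueₚ
open import Data.Vec as Vec using (Vec; []; _∷_; toList; tabulate)
open import Data.Vec.Properties
  using (∷-injective; length-toList; lookup-replicate; lookup∘tabulate; lookup-map; tabulate-cong)
open import Data.Fin as Fin using (Fin; toℕ)
open import Data.Fin.Properties using (toℕ-inject₁; toℕ<n)
open import Data.Integer as ℤ using (ℤ; +_; -_)
import Data.Integer.Properties as ℤₚ
open import Data.Product using (_×_; _,_; proj₁; proj₂)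
open import Data.Sum using (inj₁; inj₂)
open import Data.Empty using (⊥-elim)
open import Data.Unit using (⊤; tt)
open import Relation.Nullary using (¬_)
open import Function using (id; _∘_; flip; case_of_; _⇔_; mk⇔; Equivalence)
open import Relation.Binary.PropositionalEquality hiding (J)
open import Relation.Nullary.Decidable
  using ( Dec; does; ⌊_⌋; yes; no; T?; _×-dec_; toWitness; toWitnessFalse; fromWitness
        ; isYes≗does; dec-true; dec-false; does-⇔)

private variable
  A B : Set
  m n : ℕ
  x y : A
  xs ys : List A
  p q : A → Bool
  R : A → A → Set

indicator : Bool → ℕ
indicator b = if b then 1 else 0

count : (A → Bool) → List A → ℕ
count p xs = length (filterᵇ p xs)

count-∷ : (p : A → Bool) (x : A) (xs : List A) → count p (x ∷ xs) ≡ indicator (p x) + count p xs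
count-∷ p x xs with p x
... | true  = refl
... | false = refl

count-++ : (p : A → Bool) (xs ys : List A) → count p (xs ++ ys) ≡ count p xs + count p ys
count-++ p []       ys = refl
count-++ p (x ∷ xs) ys with p x
... | true  = cong suc (count-++ p xs ys)
... | false = count-++ p xs ys

count-map : (p : B → Bool) (f : A → B) → ∀ xs → count p (map f xs) ≡ count (p ∘ f) xs
count-map p f []       = refl
count-map p f (x ∷ xs) with p (f x)
... | true  = cong suc (count-map p f xs)
... | false = count-map p f xs

count-concatMap : (p : B → Bool) (f : A → List B) (xs : List A) →
                  count p (concatMap f xs) ≡ sum (map (count p ∘ f) xs)
count-concatMap p f []       = refl
count-concatMap p f (x ∷ xs) =
  trans (count-++ p (f x) (concatMap f xs)) (cong (_+_ (count p (f x))) (count-concatMap p f xs))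

count-cong : (∀ {x} → x ∈ xs → p x ≡ q x) → count p xs ≡ count q xs
count-cong {xs = []}     eq = refl
count-cong {xs = x ∷ xs} {p} {q} eq with p x | q x | eq (here refl)
... | true  | .true  | refl = cong suc (count-cong (eq ∘ there))
... | false | .false | refl = count-cong (eq ∘ there)

count-none : (p : A → Bool) (xs : List A) → (∀ {x} → x ∈ xs → ¬ T (p x)) → count p xs ≡ 0
count-none p []       ¬p = refl
count-none p (x ∷ xs) ¬p with p x | ¬p (here refl)
... | true  | ¬px = ⊥-elim (¬px tt)
... | false | _   = count-none p xs (¬p ∘ there)

count-∧ˡ : (b : Bool) (q : A → Bool) (xs : List A) →
           count (λ x → b ∧ q x) xs ≡ (if b then count q xs else 0)
count-∧ˡ true  q xs = refl
count-∧ˡ false q []       = refl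
count-∧ˡ false q (x ∷ xs) = count-∧ˡ false q xs

count-filterᵇ : (p q : A → Bool) (xs : List A) → count p (filterᵇ q xs) ≡ count (λ x → q x ∧ p x) xs
count-filterᵇ p q []       = refl
count-filterᵇ p q (x ∷ xs) with q x
... | false = count-filterᵇ p q xs
... | true with p x
...   | true  = cong suc (count-filterᵇ p q xs)
...   | false = count-filterᵇ p q xs

count-+-count-not : (p : A → Bool) (xs : List A) → count p xs + count (not ∘ p) xs ≡ length xs
count-+-count-not p []       = refl
count-+-count-not p (x ∷ xs) with p x
... | true  = cong suc (count-+-count-not p xs)
... | false = trans (+-suc _ _) (cong suc (count-+-count-not p xs))

count-pos : x ∈ xs → T (p x) → 0 < count p xs
count-pos {p = p} x∈xs px = filter-some (T? ∘ p) (lose x∈xs px)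

count≡sum : (p : A → Bool) (xs : List A) → count p xs ≡ sum (map (indicator ∘ p) xs)
count≡sum p []       = refl
count≡sum p (x ∷ xs) with p x
... | true  = cong suc (count≡sum p xs)
... | false = count≡sum p xs

count-≟-unique : (xs : List ℕ) {a : ℕ} → Unique xs → a ∈ xs → count (λ x → does (x ≟ a)) xs ≡ 1
count-≟-unique (x ∷ xs) (x≢xs ∷ _) (here refl) = trans (count-∷ (λ y → does (y ≟ x)) x xs)
  (cong₂ _+_ (cong indicator (dec-true (x ≟ x) refl))
             (count-none _ xs λ {y} y∈ y≡x → All.lookup x≢xs y∈ (sym (≡ᵇ⇒≡ y x y≡x))))
count-≟-unique (x ∷ xs) {a} (x≢xs ∷ uniq) (there a∈) = trans (count-∷ (λ y → does (y ≟ a)) x xs)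
  (cong₂ _+_ (cong indicator (dec-false (x ≟ _) (All.lookup x≢xs a∈))) (count-≟-unique xs uniq a∈))

sum-map-+ : (f g : A → ℕ) (xs : List A) →
            sum (map (λ x → f x + g x) xs) ≡ sum (map f xs) + sum (map g xs)
sum-map-+ f g []       = refl
sum-map-+ f g (x ∷ xs) =
  trans (cong (_+_ (f x + g x)) (sum-map-+ f g xs)) (+-interchange (f x) (g x) _ _)

sum-map-swap : (f : A → B → ℕ) (xs : List A) (ys : List B) →
               sum (map (λ x → sum (map (f x) ys)) xs) ≡ sum (map (λ y → sum (map (λ x → f x y) xs)) ys)
sum-map-swap f []       ys = sym (sum-map-0 ys)
  where
  sum-map-0 : (ys : List B) → sum (map (λ _ → 0) ys) ≡ 0
  sum-map-0 []       = refl
  sum-map-0 (_ ∷ ys) = sum-map-0 ys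
sum-map-swap f (x ∷ xs) ys =
  trans (cong (_+_ (sum (map (f x) ys))) (sum-map-swap f xs ys))
        (sym (sum-map-+ (f x) (λ y → sum (map (λ x → f x y) xs)) ys))

sum-map-delete : (f : A → ℕ) (xs : List A) → f x ≡ 0 → sum (map f (xs ++ x ∷ ys)) ≡ sum (map f (xs ++ ys))
sum-map-delete {ys = ys} f []       fx≡0 = cong (_+ sum (map f ys)) fx≡0
sum-map-delete f (y ∷ xs) fx≡0 = cong (_+_ (f y)) (sum-map-delete f xs fx≡0)

∑< : ℕ → (ℕ → ℕ) → ℕ
∑< zero    f = 0
∑< (suc n) f = f 0 + ∑< n (f ∘ suc)

sum-map-applyUpTo : (f g : ℕ → ℕ) (n : ℕ) → sum (map f (applyUpTo g n)) ≡ ∑< n (f ∘ g)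
sum-map-applyUpTo f g zero    = refl
sum-map-applyUpTo f g (suc n) = cong (_+_ (f (g 0))) (sum-map-applyUpTo f (g ∘ suc) n)

sum-map-by-position : (φ : A → ℕ) (ψ : ℕ → ℕ) (xs : List A) →
  (∀ ys x zs → xs ≡ ys ++ x ∷ zs → φ x ≡ ψ (length ys)) →
  sum (map φ xs) ≡ ∑< (length xs) ψ
sum-map-by-position φ ψ []       _  = refl
sum-map-by-position φ ψ (x ∷ xs) at = cong₂ _+_ (at [] x xs refl)
  (sum-map-by-position φ (ψ ∘ suc) xs (λ ys y zs eq → at (x ∷ ys) y zs (cong (x ∷_) eq)))

∑<-cong : {f g : ℕ → ℕ} (n : ℕ) → (∀ i → i < n → f i ≡ g i) → ∑< n f ≡ ∑< n g
∑<-cong zero    eq = refl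
∑<-cong (suc n) eq = cong₂ _+_ (eq 0 (s≤s z≤n)) (∑<-cong n (λ i i<n → eq (suc i) (s≤s i<n)))

∑<-const : {f : ℕ → ℕ} {a : ℕ} (n : ℕ) → (∀ i → i < n → f i ≡ a) → ∑< n f ≡ n * a
∑<-const zero    eq = refl
∑<-const (suc n) eq = cong₂ _+_ (eq 0 (s≤s z≤n)) (∑<-const n (λ i i<n → eq (suc i) (s≤s i<n)))

∑<-truncate : {f : ℕ → ℕ} {k n : ℕ} → k ≤ n → (∀ i → k ≤ i → f i ≡ 0) → ∑< n f ≡ ∑< k f
∑<-truncate {k = zero}  {n} _          vanish = trans (∑<-const n (λ i _ → vanish i z≤n)) (*-zeroʳ n)
∑<-truncate {f} {k = suc k} (s≤s k≤n) vanish =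
  cong (_+_ (f 0)) (∑<-truncate k≤n (λ i k≤i → vanish (suc i) (s≤s k≤i)))

∑<-snoc : (f : ℕ → ℕ) (n : ℕ) → ∑< (suc n) f ≡ ∑< n f + f n
∑<-snoc f zero    = +-comm (f 0) 0
∑<-snoc f (suc n) = trans (cong (_+_ (f 0)) (∑<-snoc (f ∘ suc) n)) (sym (+-assoc (f 0) _ _))

∑<-reverse : (f : ℕ → ℕ) (n : ℕ) → ∑< n (λ i → f (n ∸ suc i)) ≡ ∑< n f
∑<-reverse f zero    = refl
∑<-reverse f (suc n) = begin
  f n + ∑< n (λ i → f (n ∸ suc i)) ≡⟨ cong (_+_ (f n)) (∑<-reverse f n) ⟩
  f n + ∑< n f                     ≡⟨ +-comm (f n) _ ⟩
  ∑< n f + f n                     ≡⟨ ∑<-snoc f n ⟨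
  ∑< (suc n) f                     ∎
  where open ≡-Reasoning

count-vecsOver-suc : (p : Vec A (suc m) → Bool) (xs : List A) →
  count p (vecsOver xs (suc m)) ≡ sum (map (λ x → count (p ∘ (x ∷_)) (vecsOver xs m)) xs)
count-vecsOver-suc {m = m} p xs = begin
  count p (concatMap (λ x → map (x ∷_) (vecsOver xs m)) xs)
    ≡⟨ count-concatMap p (λ x → map (x ∷_) (vecsOver xs m)) xs ⟩
  sum (map (λ x → count p (map (x ∷_) (vecsOver xs m))) xs)
    ≡⟨ cong sum (map-cong (λ x → count-map p (x ∷_) (vecsOver xs m)) xs) ⟩
  sum (map (λ x → count (p ∘ (x ∷_)) (vecsOver xs m)) xs) ∎
  where open ≡-Reasoning

count-vecsOver-suc′ : (p : Vec A (suc m) → Bool) (xs : List A) →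
  count p (vecsOver xs (suc m)) ≡ sum (map (λ v → count (λ x → p (x ∷ v)) xs) (vecsOver xs m))
count-vecsOver-suc′ {m = m} p xs = begin
  count p (vecsOver xs (suc m))
    ≡⟨ count-vecsOver-suc p xs ⟩
  sum (map (λ x → count (p ∘ (x ∷_)) (vecsOver xs m)) xs)
    ≡⟨ cong sum (map-cong (λ x → count≡sum (p ∘ (x ∷_)) (vecsOver xs m)) xs) ⟩
  sum (map (λ x → sum (map (λ v → indicator (p (x ∷ v))) (vecsOver xs m))) xs)
    ≡⟨ sum-map-swap (λ x v → indicator (p (x ∷ v))) xs (vecsOver xs m) ⟩
  sum (map (λ v → sum (map (λ x → indicator (p (x ∷ v))) xs)) (vecsOver xs m))
    ≡⟨ cong sum (map-cong (λ v → count≡sum (λ x → p (x ∷ v)) xs) (vecsOver xs m)) ⟨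
  sum (map (λ v → count (λ x → p (x ∷ v)) xs) (vecsOver xs m)) ∎
  where open ≡-Reasoning

∈-vecsOver⁺ : {v : Vec A m} → All (_∈ xs) (toList v) → v ∈ vecsOver xs m
∈-vecsOver⁺ {v = []}    []           = here refl
∈-vecsOver⁺ {v = y ∷ v} (y∈xs ∷ v∈) =
  ∈-concatMap⁺ _ (Any.map (λ { refl → ∈-map⁺ (y ∷_) (∈-vecsOver⁺ v∈) }) y∈xs)

∈-vecsOver⁻ : {v : Vec A m} → v ∈ vecsOver xs m → All (_∈ xs) (toList v)
∈-vecsOver⁻ {v = []}    _    = []
∈-vecsOver⁻ {m = suc m} {xs = xs} {v = y ∷ v} y∷v∈
  with x , x∈xs , y∷v∈′ ← find (∈-concatMap⁻ (λ x → map (x ∷_) (vecsOver xs m)) y∷v∈)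
  with v′ , v′∈ , eq ← ∈-map⁻ (x ∷_) y∷v∈′
  with refl , refl ← ∷-injective eq
  = x∈xs ∷ ∈-vecsOver⁻ v′∈

∈-natVecs⁺ : {v : Vec ℕ m} {b : ℕ} → All (_≤ b) (toList v) → v ∈ natVecs m b
∈-natVecs⁺ = ∈-vecsOver⁺ ∘ All.map (∈-upTo⁺ ∘ s≤s)

count-vecsOver-delete : (p : Vec A m → Bool) (xs : List A) →
  (∀ v → T (p v) → x ∉ toList v) →
  count p (vecsOver (xs ++ x ∷ ys) m) ≡ count p (vecsOver (xs ++ ys) m)
count-vecsOver-delete {m = zero}  p xs x∉ = refl
count-vecsOver-delete {A = A} {m = suc m} {x = x} {ys = ys} p xs x∉ = begin
  count p (vecsOver (xs ++ x ∷ ys) (suc m))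
    ≡⟨ count-vecsOver-suc p (xs ++ x ∷ ys) ⟩
  sum (map (λ y → count (p ∘ (y ∷_)) (vecsOver (xs ++ x ∷ ys) m)) (xs ++ x ∷ ys))
    ≡⟨ cong sum (map-cong (λ y → count-vecsOver-delete (p ∘ (y ∷_)) xs (λ v pyv → x∉ (y ∷ v) pyv ∘ there))
                         (xs ++ x ∷ ys)) ⟩
  sum (map F (xs ++ x ∷ ys))
    ≡⟨ sum-map-delete F xs
         (count-none (p ∘ (x ∷_)) (vecsOver (xs ++ ys) m) (λ {v} _ pxv → x∉ (x ∷ v) pxv (here refl))) ⟩
  sum (map F (xs ++ ys))
    ≡⟨ count-vecsOver-suc p (xs ++ ys) ⟨
  count p (vecsOver (xs ++ ys) (suc m)) ∎
  where
  open ≡-Reasoning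
  F : A → ℕ
  F y = count (p ∘ (y ∷_)) (vecsOver (xs ++ ys) m)

-- Permutations and their inversions

∈-delete : (xs : List A) → y ∈ xs ++ x ∷ ys → x ≢ y → y ∈ xs ++ ys
∈-delete []       (here refl)  x≢y = ⊥-elim (x≢y refl)
∈-delete []       (there y∈)   x≢y = y∈
∈-delete (z ∷ xs) (here refl)  x≢y = here refl
∈-delete (z ∷ xs) (there y∈)   x≢y = there (∈-delete xs y∈ x≢y)

pigeonhole : Unique xs → All (_∈ ys) xs → length xs ≤ length ys
pigeonhole []            []             = z≤n
pigeonhole (x≢xs ∷ uniq) (x∈ys ∷ xs⊆ys) with ys₁ , ys₂ , refl ← ∈-∃++ x∈ys =
  subst (_ ≤_) (sym (length-++-sucʳ ys₁ _ ys₂))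
    (s≤s (pigeonhole uniq (All.zipWith (λ (x≢y , y∈) → ∈-delete ys₁ y∈ x≢y) (x≢xs , xs⊆ys))))

AllPairs-pivot : (xs : List A) → AllPairs R (xs ++ x ∷ ys) → All (flip R x) xs × All (R x) ys
AllPairs-pivot []       (Rx ∷ _)  = [] , Rx
AllPairs-pivot (z ∷ xs) (Rz ∷ ap) with below , above ← AllPairs-pivot xs ap =
  All.head (Allₚ.++⁻ʳ xs Rz) ∷ below , above

All-delete : (xs : List A) {P : A → Set} → All P (xs ++ x ∷ ys) → All P (xs ++ ys)
All-delete []       (_ ∷ Pys)  = Pys
All-delete (z ∷ xs) (Pz ∷ Pxs) = Pz ∷ All-delete xs Pxs

AllPairs-delete : (xs : List A) → AllPairs R (xs ++ x ∷ ys) → AllPairs R (xs ++ ys)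
AllPairs-delete []       (_ ∷ ap)  = ap
AllPairs-delete (z ∷ xs) (Rz ∷ ap) = All-delete xs Rz ∷ AllPairs-delete xs ap

pivot∉ : (S₁ : List ℕ) {S₂ : List ℕ} → AllPairs _<_ (S₁ ++ x ∷ S₂) → x ∉ S₁ ++ S₂
pivot∉ S₁ sorted x∈ with below , above ← AllPairs-pivot S₁ sorted | ∈-++⁻ S₁ x∈
... | inj₁ x∈S₁ = <-irrefl refl (All.lookup below x∈S₁)
... | inj₂ x∈S₂ = <-irrefl refl (All.lookup above x∈S₂)

-- Pigeonhole twice: the letters of ws below x lie in S₁, the others in S₂, and there are |S₁| + |S₂| letters.
count-below-pivot : (S₁ : List ℕ) {S₂ ws : List ℕ} → AllPairs _<_ (S₁ ++ x ∷ S₂) →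
       Unique ws → All (_∈ S₁ ++ S₂) ws → length ws ≡ length (S₁ ++ S₂) →
       count (λ y → ⌊ y <? x ⌋) ws ≡ length S₁
count-below-pivot {x = x} S₁ {S₂} {ws} sorted uniq ws⊆ |ws| = ≤-antisym lower≤ (+-cancelʳ-≤ _ _ _ total≤)
  where
  below = proj₁ (AllPairs-pivot S₁ sorted)
  above = proj₂ (AllPairs-pivot S₁ sorted)
  below? : ℕ → Bool
  below? y = ⌊ y <? x ⌋
  selected⊆ : (q : ℕ → Bool) {S : List ℕ} → (∀ {y} → y ∈ S₁ ++ S₂ → T (q y) → y ∈ S) →
              length (filterᵇ q ws) ≤ length S
  selected⊆ q into = pigeonhole (Uniqueₚ.filter⁺ (T? ∘ q) uniq)
    (All.zipWith (λ (y∈ , qy) → into y∈ qy) (Allₚ.filter⁺ (T? ∘ q) ws⊆ , Allₚ.all-filter (T? ∘ q) ws))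
  lower≤ : count below? ws ≤ length S₁
  lower≤ = selected⊆ below? λ {y} y∈ y<x → case ∈-++⁻ S₁ y∈ of λ where
    (inj₁ y∈S₁) → y∈S₁
    (inj₂ y∈S₂) → ⊥-elim (<-asym (toWitness y<x) (All.lookup above y∈S₂))
  upper≤ : count (not ∘ below?) ws ≤ length S₂
  upper≤ = selected⊆ (not ∘ below?) λ {y} y∈ y≮x → case ∈-++⁻ S₁ y∈ of λ where
    (inj₁ y∈S₁) → ⊥-elim (toWitnessFalse y≮x (All.lookup below y∈S₁))
    (inj₂ y∈S₂) → y∈S₂
  total≤ : length S₁ + length S₂ ≤ count below? ws + length S₂
  total≤ = begin
    length S₁ + length S₂            ≡⟨ length-++ S₁ ⟨
    length (S₁ ++ S₂)                ≡⟨ |ws| ⟨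
    length ws                        ≡⟨ count-+-count-not below? ws ⟨
    count below? ws + count (not ∘ below?) ws  ≤⟨ +-monoʳ-≤ (count below? ws) upper≤ ⟩
    count below? ws + length S₂           ∎
    where open ≤-Reasoning

T-allL : (p : A → Bool) (xs : List A) → T (allL p xs) ⇔ All (T ∘ p) xs
T-allL p []       = mk⇔ (λ _ → []) (λ _ → tt)
T-allL p (x ∷ xs) = mk⇔
  (λ t → let px , pxs = Equivalence.to T-∧ t in px ∷ Equivalence.to (T-allL p xs) pxs)
  (λ { (px ∷ pxs) → Equivalence.from T-∧ (px , Equivalence.from (T-allL p xs) pxs) })

T-≢ᵇ : (x y : ℕ) → T (⌊ x ≟ y ⌋ xor true) ⇔ x ≢ y
T-≢ᵇ x y with x ≟ y
... | yes x≡y = mk⇔ (λ ()) (λ x≢y → x≢y x≡y)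
... | no  x≢y = mk⇔ (λ _ → x≢y) (λ _ → tt)

T-allL-≢ᵇ : (x : ℕ) (xs : List ℕ) → T (allL (λ y → ⌊ x ≟ y ⌋ xor true) xs) ⇔ x ∉ xs
T-allL-≢ᵇ x xs = mk⇔
  (Allₚ.All¬⇒¬Any ∘ All.map (Equivalence.to (T-≢ᵇ x _)) ∘ Equivalence.to (T-allL _ xs))
  (Equivalence.from (T-allL _ xs) ∘ All.map (Equivalence.from (T-≢ᵇ x _)) ∘ Allₚ.¬Any⇒All¬ xs)

distinctᵇ⇒Unique : (xs : List ℕ) → T (distinctᵇ xs) → Unique xs
distinctᵇ⇒Unique []       _ = []
distinctᵇ⇒Unique (x ∷ xs) t with x∉ , dxs ← Equivalence.to T-∧ t =
  Allₚ.¬Any⇒All¬ xs (Equivalence.to (T-allL-≢ᵇ x xs) x∉) ∷ distinctᵇ⇒Unique xs dxs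

distinctᵇ-∷⁻ : T (distinctᵇ (x ∷ xs)) → x ∉ xs
distinctᵇ-∷⁻ {x = x} {xs} = Equivalence.to (T-allL-≢ᵇ x xs) ∘ proj₁ ∘ Equivalence.to T-∧

distinctᵇ-∷ : x ∉ xs → distinctᵇ (x ∷ xs) ≡ distinctᵇ xs
distinctᵇ-∷ {x = x} {xs} x∉ = cong (_∧ distinctᵇ xs) (Equivalence.to T-≡ (Equivalence.from (T-allL-≢ᵇ x xs) x∉))

-- The number of Lehmer codes (d₀, …, d_{m−1}), 0 ≤ d_k ≤ m − 1 − k, with d₀ + ⋯ + d_{m−1} ≤ t,
-- by recursion on d₀.
lehmerCount : ℕ → ℕ → ℕ
lehmerCount zero    t = 1
lehmerCount (suc m) t = ∑< (suc m) λ d → if does (d ≤? t) then lehmerCount m (t ∸ d) else 0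

[1+m]C2≡m+mC2 : ∀ m → suc m C 2 ≡ m + m C 2
[1+m]C2≡m+mC2 m = trans (sym (nCk+nC[k+1]≡[n+1]C[k+1] m 1)) (cong (_+ m C 2) (nC1≡n m))

+≤⇔ : ∀ a b t → a + b ≤ t ⇔ (a ≤ t × b ≤ t ∸ a)
+≤⇔ a b t = mk⇔
  (λ a+b≤t → m+n≤o⇒m≤o a a+b≤t , m+n≤o⇒m≤o∸n b (subst (_≤ t) (+-comm a b) a+b≤t))
  (λ (a≤t , b≤t∸a) → subst (_≤ t) (+-comm b a) (m≤o∸n⇒m+n≤o b a≤t b≤t∸a))

fewInversionsᵇ : ℕ → List ℕ → Bool
fewInversionsᵇ t ws = distinctᵇ ws ∧ does (inversions ws ≤? t)

fewInversionsᵇ-∷ : (S₁ : List ℕ) {S₂ ws : List ℕ} (t : ℕ) → AllPairs _<_ (S₁ ++ x ∷ S₂) →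
  All (_∈ S₁ ++ S₂) ws → length ws ≡ length (S₁ ++ S₂) →
  fewInversionsᵇ t (x ∷ ws) ≡ does (length S₁ ≤? t) ∧ fewInversionsᵇ (t ∸ length S₁) ws
fewInversionsᵇ-∷ {x = x} S₁ {ws = ws} t sorted ws⊆ |ws|
  rewrite distinctᵇ-∷ (pivot∉ S₁ sorted ∘ All.lookup ws⊆)
  with distinctᵇ ws in distinct
... | false = sym (∧-zeroʳ _)
... | true  = begin
  does (count (λ y → ⌊ y <? x ⌋) ws + inversions ws ≤? t)
    ≡⟨ cong (λ r → does (r + inversions ws ≤? t)) (count-below-pivot S₁ sorted uniq ws⊆ |ws|) ⟩
  does (length S₁ + inversions ws ≤? t)
    ≡⟨ does-⇔ (+≤⇔ (length S₁) (inversions ws) t) (_ ≤? t) (_ ≤? t ×-dec _ ≤? t ∸ length S₁) ⟩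
  does (length S₁ ≤? t) ∧ does (inversions ws ≤? t ∸ length S₁) ∎
  where
  open ≡-Reasoning
  uniq : Unique ws
  uniq = distinctᵇ⇒Unique ws (subst T (sym distinct) tt)

count-fewInversions : (k : ℕ) (S : List ℕ) → length S ≡ k → AllPairs _<_ S → (t : ℕ) →
  count (fewInversionsᵇ t ∘ toList) (vecsOver S k) ≡ lehmerCount k t
count-fewInversions zero    S _   _      t = refl
count-fewInversions (suc k) S |S| sorted t = begin
  count (fewInversionsᵇ t ∘ toList) (vecsOver S (suc k))
    ≡⟨ count-vecsOver-suc _ S ⟩
  sum (map (λ x → count (λ w → fewInversionsᵇ t (x ∷ toList w)) (vecsOver S k)) S)
    ≡⟨ sum-map-by-position _ term S starting-with ⟩
  ∑< (length S) term
    ≡⟨ cong (λ n → ∑< n term) |S| ⟩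
  lehmerCount (suc k) t ∎
  where
  open ≡-Reasoning
  term : ℕ → ℕ
  term r = if does (r ≤? t) then lehmerCount k (t ∸ r) else 0
  starting-with : ∀ S₁ x S₂ → S ≡ S₁ ++ x ∷ S₂ →
                  count (λ w → fewInversionsᵇ t (x ∷ toList w)) (vecsOver S k) ≡ term (length S₁)
  starting-with S₁ x S₂ refl = begin
    count (λ w → fewInversionsᵇ t (x ∷ toList w)) (vecsOver (S₁ ++ x ∷ S₂) k)
      ≡⟨ count-vecsOver-delete {m = k} {ys = S₂} (λ w → fewInversionsᵇ t (x ∷ toList w)) S₁
                               (λ w → distinctᵇ-∷⁻ ∘ proj₁ ∘ Equivalence.to T-∧) ⟩
    count (λ w → fewInversionsᵇ t (x ∷ toList w)) (vecsOver (S₁ ++ S₂) k)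
      ≡⟨ count-cong {xs = vecsOver (S₁ ++ S₂) k} (λ {w} w∈ →
           fewInversionsᵇ-∷ S₁ t sorted (∈-vecsOver⁻ w∈) (trans (length-toList w) (sym |S₁++S₂|))) ⟩
    count (λ w → does (r ≤? t) ∧ fewInversionsᵇ (t ∸ r) (toList w)) (vecsOver (S₁ ++ S₂) k)
      ≡⟨ count-∧ˡ (does (r ≤? t)) (fewInversionsᵇ (t ∸ r) ∘ toList) (vecsOver (S₁ ++ S₂) k) ⟩
    (if does (r ≤? t) then count (fewInversionsᵇ (t ∸ r) ∘ toList) (vecsOver (S₁ ++ S₂) k) else 0)
      ≡⟨ cong (λ n → if does (r ≤? t) then n else 0)
              (count-fewInversions k (S₁ ++ S₂) |S₁++S₂| (AllPairs-delete S₁ sorted) (t ∸ r)) ⟩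
    term r ∎
    where
    r = length S₁
    |S₁++S₂| : length (S₁ ++ S₂) ≡ k
    |S₁++S₂| = suc-injective (trans (sym (length-++-sucʳ S₁ x S₂)) |S|)

J≡lehmerCount : (m t : ℕ) → J m t ≡ lehmerCount m t
J≡lehmerCount m t = begin
  J m t
    ≡⟨ count-filterᵇ _ (isPermWordᵇ m) (natVecs m m) ⟩
  count (λ w → isPermWordᵇ m w ∧ ⌊ inversions (toList w) ≤? t ⌋) (vecsOver ([] ++ 0 ∷ S) m)
    -- the alphabet upTo (suc m) of natVecs m m is 0 ∷ S, and a permutation word never uses 0
    ≡⟨ count-vecsOver-delete _ [] (λ w ok → All.lookup (positive w ok)) ⟩
  count (λ w → isPermWordᵇ m w ∧ ⌊ inversions (toList w) ≤? t ⌋) (vecsOver S m)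
    ≡⟨ count-cong {xs = vecsOver S m} (λ {w} w∈ → cong₂ (λ b b′ → (b ∧ distinctᵇ (toList w)) ∧ b′)
                                    (Equivalence.to T-≡ (Equivalence.from (T-allL _ (toList w))
                                       (All.map letter-positive (∈-vecsOver⁻ w∈))))
                                    (isYes≗does (inversions (toList w) ≤? t))) ⟩
  count (fewInversionsᵇ t ∘ toList) (vecsOver S m)
    ≡⟨ count-fewInversions m S (length-applyUpTo suc m) (AllPairsₚ.applyUpTo⁺₁ suc m (λ i<j _ → s≤s i<j)) t ⟩
  lehmerCount m t ∎
  where
  open ≡-Reasoning
  S = applyUpTo suc m
  positive : (w : Vec ℕ m) → T (isPermWordᵇ m w ∧ ⌊ inversions (toList w) ≤? t ⌋) →
             All (λ x → T ⌊ 1 ≤? x ⌋) (toList w)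
  positive w ok =
    Equivalence.to (T-allL _ (toList w)) (proj₁ (Equivalence.to T-∧ (proj₁ (Equivalence.to T-∧ ok))))
  letter-positive : ∀ {x} → x ∈ S → T ⌊ 1 ≤? x ⌋
  letter-positive x∈ with _ , _ , refl ← ∈-applyUpTo⁻ suc x∈ = tt

lehmerCount-saturated : (m t : ℕ) → m C 2 ≤ t → lehmerCount m t ≡ m !
lehmerCount-saturated zero    t _   = refl
lehmerCount-saturated (suc m) t sat = ∑<-const (suc m) λ d d<1+m → term≡m! (≤-pred d<1+m)
  where
  m+mC2≤t : m + m C 2 ≤ t
  m+mC2≤t = subst (_≤ t) ([1+m]C2≡m+mC2 m) sat
  term≡m! : ∀ {d} → d ≤ m → (if does (d ≤? t) then lehmerCount m (t ∸ d) else 0) ≡ m !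
  term≡m! {d} d≤m
    with d≤t , mC2≤t∸d ← Equivalence.to (+≤⇔ d (m C 2) t) (≤-trans (+-monoˡ-≤ (m C 2) d≤m) m+mC2≤t)
    = trans (cong (if_then lehmerCount m (t ∸ d) else 0) (dec-true (d ≤? t) d≤t))
            (lehmerCount-saturated m (t ∸ d) mC2≤t∸d)

-- Vectors under the staircase

0<nCk⇔k≤n : ∀ n k → 0 < n C k ⇔ k ≤ n
0<nCk⇔k≤n n k = mk⇔ (λ 0<nCk → ≮⇒≥ λ n<k → <-irrefl (sym (k>n⇒nCk≡0 n<k)) 0<nCk) (nCk>0 n k)
  where
  nCk>0 : ∀ n k → k ≤ n → 0 < n C k
  nCk>0 n       zero    _         = s≤s z≤n
  nCk>0 (suc n) (suc k) (s≤s k≤n) =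
    subst (0 <_) (nCk+nC[k+1]≡[n+1]C[k+1] n k) (≤-trans (nCk>0 n k k≤n) (m≤m+n _ _))

0<m*n⇔ : ∀ a b → 0 < a * b ⇔ (0 < a × 0 < b)
0<m*n⇔ a b = mk⇔
  (λ 0<ab → n≢0⇒n>0 (λ { refl → <-irrefl refl 0<ab })
          , n≢0⇒n>0 (λ { refl → <-irrefl (sym (*-zeroʳ a)) 0<ab }))
  (λ (0<a , 0<b) → *-mono-< 0<a 0<b)

Staircase : Vec ℕ m → Set
Staircase []            = ⊤
Staircase {suc m} (y ∷ c) = y ≤ m × Staircase c

staircase? : (c : Vec ℕ m) → Dec (Staircase c)
staircase? []            = yes tt
staircase? {suc m} (y ∷ c) = y ≤? m ×-dec staircase? c

stairWeight : Vec ℕ m → ℕ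
stairWeight []            = 1
stairWeight {suc m} (y ∷ c) = (m C y) * stairWeight c

0<stairWeight⇔ : (c : Vec ℕ m) → 0 < stairWeight c ⇔ Staircase c
0<stairWeight⇔ []            = mk⇔ (λ _ → tt) (λ _ → s≤s z≤n)
0<stairWeight⇔ {suc m} (y ∷ c) = mk⇔
  (λ pos → let (0<C , 0<w) = Equivalence.to (0<m*n⇔ (m C y) _) pos in
           Equivalence.to (0<nCk⇔k≤n m y) 0<C , Equivalence.to (0<stairWeight⇔ c) 0<w)
  (λ (y≤m , stair) → Equivalence.from (0<m*n⇔ (m C y) _)
                       (Equivalence.from (0<nCk⇔k≤n m y) y≤m , Equivalence.from (0<stairWeight⇔ c) stair))

-- The gaps between c and the staircase, then a 0: the demands of the vertices 1, …, m + 1 in j − δ.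
deficits : Vec ℕ m → Vec ℕ (suc m)
deficits []            = 0 ∷ []
deficits {suc m} (y ∷ c) = (m ∸ y) ∷ deficits c

sum+sum-deficits : (c : Vec ℕ m) → Staircase c → Vec.sum c + Vec.sum (deficits c) ≡ m C 2
sum+sum-deficits []            _            = refl
sum+sum-deficits {suc m} (y ∷ c) (y≤m , stair) = begin
  y + Vec.sum c + (m ∸ y + Vec.sum (deficits c)) ≡⟨ +-interchange y _ _ _ ⟩
  y + (m ∸ y) + (Vec.sum c + Vec.sum (deficits c)) ≡⟨ cong₂ _+_ (m+[n∸m]≡n y≤m) (sum+sum-deficits c stair) ⟩
  m + m C 2                                        ≡⟨ [1+m]C2≡m+mC2 m ⟨
  suc m C 2 ∎
  where open ≡-Reasoning

sum≤mC2 : (c : Vec ℕ m) → Staircase c → Vec.sum c ≤ m C 2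
sum≤mC2 c stair = subst (Vec.sum c ≤_) (sum+sum-deficits c stair) (m≤m+n _ _)

NearStaircase : ℕ → Vec ℕ m → Set
NearStaircase {m} t c = Staircase c × m C 2 ∸ Vec.sum c ≤ t

nearStaircase? : (t : ℕ) (c : Vec ℕ m) → Dec (NearStaircase t c)
nearStaircase? {m} t c = staircase? c ×-dec m C 2 ∸ Vec.sum c ≤? t

gap-∷ : (y : ℕ) (c : Vec ℕ m) → y ≤ m → Staircase c →
        suc m C 2 ∸ (y + Vec.sum c) ≡ m ∸ y + (m C 2 ∸ Vec.sum c)
gap-∷ {m} y c y≤m stair = begin
  suc m C 2 ∸ (y + s) ≡⟨ cong (_∸ (y + s)) ([1+m]C2≡m+mC2 m) ⟩
  m + m C 2 ∸ (y + s) ≡⟨ ∸-+-assoc (m + m C 2) y s ⟨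
  m + m C 2 ∸ y ∸ s   ≡⟨ cong (_∸ s) (+-∸-comm (m C 2) y≤m) ⟩
  m ∸ y + m C 2 ∸ s   ≡⟨ +-∸-assoc (m ∸ y) (sum≤mC2 c stair) ⟩
  m ∸ y + (m C 2 ∸ s) ∎
  where
  s = Vec.sum c
  open ≡-Reasoning

nearStaircase-∷ : (t y : ℕ) (c : Vec ℕ m) →
  NearStaircase t (y ∷ c) ⇔ (y ≤ m × m ∸ y ≤ t × NearStaircase (t ∸ (m ∸ y)) c)
nearStaircase-∷ {m} t y c = mk⇔
  (λ ((y≤m , stair) , gap≤t) →
    let d≤t , gap′≤ = Equivalence.to (+≤⇔ _ _ t) (subst (_≤ t) (gap-∷ y c y≤m stair) gap≤t)
    in y≤m , d≤t , stair , gap′≤)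
  (λ (y≤m , d≤t , stair , gap′≤) →
    (y≤m , stair) , subst (_≤ t) (sym (gap-∷ y c y≤m stair)) (Equivalence.from (+≤⇔ _ _ t) (d≤t , gap′≤)))

count-nearStaircase : (m b t : ℕ) → m ≤ b → count (does ∘ nearStaircase? t) (natVecs m b) ≡ lehmerCount m t
count-nearStaircase zero    b t _   = refl
count-nearStaircase (suc m) b t 1+m≤b = begin
  count (does ∘ nearStaircase? t) (vecsOver (upTo (suc b)) (suc m))
    ≡⟨ count-vecsOver-suc {m = m} (does ∘ nearStaircase? t) (upTo (suc b)) ⟩
  sum (map first-entry (upTo (suc b)))
    ≡⟨ sum-map-applyUpTo first-entry id (suc b) ⟩
  ∑< (suc b) first-entry
    ≡⟨ ∑<-cong (suc b) (λ y _ → count-first-entry y) ⟩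
  ∑< (suc b) (λ y → if does (y ≤? m) then term (m ∸ y) else 0)
    ≡⟨ ∑<-truncate (m≤n⇒m≤1+n 1+m≤b)
                   (λ y m<y → cong (if_then term (m ∸ y) else 0) (dec-false (y ≤? m) (<⇒≱ m<y))) ⟩
  ∑< (suc m) (λ y → if does (y ≤? m) then term (m ∸ y) else 0)
    ≡⟨ ∑<-cong (suc m) (λ y y<1+m → cong (if_then term (m ∸ y) else 0) (dec-true (y ≤? m) (≤-pred y<1+m))) ⟩
  ∑< (suc m) (λ y → term (m ∸ y))
    ≡⟨ ∑<-reverse term (suc m) ⟩
  lehmerCount (suc m) t ∎
  where
  open ≡-Reasoning
  term : ℕ → ℕ
  term d = if does (d ≤? t) then lehmerCount m (t ∸ d) else 0
  first-entry : ℕ → ℕ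
  first-entry y = count (does ∘ nearStaircase? t ∘ (y ∷_)) (natVecs m b)
  count-first-entry : ∀ y → first-entry y ≡ (if does (y ≤? m) then term (m ∸ y) else 0)
  count-first-entry y = begin
    first-entry y
      ≡⟨ count-cong {xs = natVecs m b} (λ {c} _ → does-⇔ (nearStaircase-∷ t y c) (nearStaircase? t (y ∷ c))
                                                    (y ≤? m ×-dec m ∸ y ≤? t ×-dec nearStaircase? (t ∸ d) c)) ⟩
    count (λ c → does (y ≤? m) ∧ does (d ≤? t) ∧ does (nearStaircase? (t ∸ d) c)) (natVecs m b)
      ≡⟨ count-∧ˡ (does (y ≤? m)) _ (natVecs m b) ⟩
    (if does (y ≤? m) then count (λ c → does (d ≤? t) ∧ does (nearStaircase? (t ∸ d) c)) (natVecs m b) else 0)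
      ≡⟨ cong (if does (y ≤? m) then_else 0) (count-∧ˡ (does (d ≤? t)) _ (natVecs m b)) ⟩
    (if does (y ≤? m) then (if does (d ≤? t) then count (does ∘ nearStaircase? (t ∸ d)) (natVecs m b) else 0) else 0)
      ≡⟨ cong (λ n → if does (y ≤? m) then (if does (d ≤? t) then n else 0) else 0)
              (count-nearStaircase m b (t ∸ d) (<⇒≤ 1+m≤b)) ⟩
    (if does (y ≤? m) then term d else 0) ∎
    where d = m ∸ y

-- The star flow

sum-toList : (v : Vec ℕ n) → sum (toList v) ≡ Vec.sum v
sum-toList []      = refl
sum-toList (x ∷ v) = cong (_+_ x) (sum-toList v)

sum-toList-zeros : (v : Vec ℕ n) → (∀ i → Vec.lookup v i ≡ 0) → sum (toList v) ≡ 0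
sum-toList-zeros []      _    = refl
sum-toList-zeros (x ∷ v) zeros = cong₂ _+_ (zeros Fin.zero) (sum-toList-zeros v (zeros ∘ Fin.suc))

All-≤-sum : (v : Vec ℕ n) → All (_≤ Vec.sum v) (toList v)
All-≤-sum []      = []
All-≤-sum (x ∷ v) = m≤m+n x _ ∷ All.map (λ y≤ → ≤-trans y≤ (m≤n+m _ x)) (All-≤-sum v)

All-replicate : {P : A → Set} → P x → All P (toList (Vec.replicate n x))
All-replicate {n = zero}  Px = []
All-replicate {n = suc n} Px = Px ∷ All-replicate Px

T-allB : (p : Fin n → Bool) → (∀ i → T (p i)) → T (allB p)
T-allB {n = zero}  p all = tt
T-allB {n = suc n} p all = Equivalence.from T-∧ (all Fin.zero , T-allB (p ∘ Fin.suc) (all ∘ Fin.suc))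

starFlow : Vec ℕ n → Mat (suc n)
starFlow {n} a = (0 ∷ a) ∷ Vec.replicate n (Vec.replicate (suc n) 0)

starNet : Vec ℕ n → Vec ℤ (suc n)
starNet a = + Vec.sum a ∷ Vec.map (λ k → - + k) a

starFlow-lower-row : (a : Vec ℕ n) (i : Fin n) (j : Fin (suc n)) → entry (starFlow a) (Fin.suc i) j ≡ 0
starFlow-lower-row {n} a i j =
  trans (cong (λ row → Vec.lookup row j) (lookup-replicate i (Vec.replicate (suc n) 0))) (lookup-replicate j 0)

starFlow-upper : (a : Vec ℕ n) → T (upperᵇ (starFlow a))
starFlow-upper a = T-allB _ λ i → T-allB _ λ j → on-or-below-diagonal i j
  where
  on-or-below-diagonal : ∀ i j → T (if ⌊ toℕ j ≤? toℕ i ⌋ then ⌊ entry (starFlow a) i j ≟ 0 ⌋ else true)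
  on-or-below-diagonal i j with toℕ j ≤? toℕ i
  ... | no  _ = tt
  on-or-below-diagonal Fin.zero    Fin.zero     | yes _ = tt
  on-or-below-diagonal (Fin.suc i) j            | yes _ = fromWitness (starFlow-lower-row a i j)

starFlow-net : (a : Vec ℕ n) (i : Fin (suc n)) →
  + outflow (starFlow a) i ℤ.- + inflow (starFlow a) i ≡ Vec.lookup (starNet a) i
starFlow-net a Fin.zero = begin
  + sum (toList a) ℤ.- + inflow (starFlow a) Fin.zero
    ≡⟨ cong₂ (λ o i → + o ℤ.- + i) (sum-toList a) nothing-in ⟩
  + Vec.sum a ℤ.- + 0
    ≡⟨ ℤₚ.+-identityʳ _ ⟩
  + Vec.sum a ∎
  where
  open ≡-Reasoning
  nothing-in : inflow (starFlow a) Fin.zero ≡ 0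
  nothing-in = sum-toList-zeros (tabulate λ k → entry (starFlow a) k Fin.zero) λ k →
    trans (lookup∘tabulate (λ k → entry (starFlow a) k Fin.zero) k) (column₀ k)
    where
    column₀ : ∀ k → entry (starFlow a) k Fin.zero ≡ 0
    column₀ Fin.zero    = refl
    column₀ (Fin.suc k) = starFlow-lower-row a k Fin.zero
starFlow-net a (Fin.suc i) = begin
  + outflow (starFlow a) (Fin.suc i) ℤ.- + inflow (starFlow a) (Fin.suc i)
    ≡⟨ cong₂ (λ o j → + o ℤ.- + j) nothing-out (cong (_+_ (Vec.lookup a i)) nothing-else-in) ⟩
  + 0 ℤ.- + (Vec.lookup a i + 0)      ≡⟨ ℤₚ.+-identityˡ _ ⟩
  - + (Vec.lookup a i + 0)            ≡⟨ cong (-_ ∘ +_) (+-identityʳ _) ⟩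
  - + Vec.lookup a i                  ≡⟨ lookup-map i (λ k → - + k) a ⟨
  Vec.lookup (Vec.map (λ k → - + k) a) i ∎
  where
  open ≡-Reasoning
  nothing-out : outflow (starFlow a) (Fin.suc i) ≡ 0
  nothing-out = sum-toList-zeros (Vec.lookup (starFlow a) (Fin.suc i)) (starFlow-lower-row a i)
  nothing-else-in : sum (toList (tabulate λ k → entry (starFlow a) (Fin.suc k) (Fin.suc i))) ≡ 0
  nothing-else-in = sum-toList-zeros (tabulate λ k → entry (starFlow a) (Fin.suc k) (Fin.suc i)) λ k →
    trans (lookup∘tabulate (λ k → entry (starFlow a) (Fin.suc k) (Fin.suc i)) k)
          (starFlow-lower-row a k (Fin.suc i))

starFlow∈ : (a : Vec ℕ n) → starFlow a ∈ vecsOver (natVecs (suc n) (flowBound (starNet a))) (suc n)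
starFlow∈ a = ∈-vecsOver⁺ (∈-natVecs⁺ (z≤n ∷ All.map (λ x≤Σ → ≤-trans x≤Σ (m≤m+n _ _)) (All-≤-sum a))
                          ∷ All-replicate (∈-natVecs⁺ (All-replicate z≤n)))

K-starNet>0 : (a : Vec ℕ n) → 0 < K n (starNet a)
K-starNet>0 {n} a = count-pos (starFlow∈ a)
  (Equivalence.from T-∧ (starFlow-upper a , T-allB balanced? (λ i → fromWitness (starFlow-net a i))))
  where
  balanced? : Fin (suc n) → Bool
  balanced? i = ⌊ + outflow (starFlow a) i ℤ.- + inflow (starFlow a) i ℤ.≟ Vec.lookup (starNet a) i ⌋

negated-deficits : (c : Vec ℕ m) → Staircase c →
  Vec.map (λ k → - + k) (deficits c) ≡ tabulate (λ i → + Vec.lookup c i ℤ.- + (m ∸ suc (toℕ i))) Vec.∷ʳ + 0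
negated-deficits []            _             = refl
negated-deficits {suc m} (y ∷ c) (y≤m , stair) =
  cong₂ _∷_ (sym (trans (ℤₚ.m-n≡m⊖n y m) (ℤₚ.⊖-≤ y≤m))) (negated-deficits c stair)

jMinusδ≡starNet : (x : ℕ) (c : Vec ℕ m) → Staircase c → x + Vec.sum c ≡ suc m C 2 →
                  jMinusδ (suc m) (x ∷ c) ≡ starNet (deficits c)
jMinusδ≡starNet {m} x c stair x+Σc≡ = cong₂ _∷_ head (sym (negated-deficits c stair))
  where
  Σc = Vec.sum c
  Σd = Vec.sum (deficits c)
  x≡m+Σd : x ≡ m + Σd
  x≡m+Σd = +-cancelʳ-≡ Σc x (m + Σd) (begin
    x + Σc              ≡⟨ x+Σc≡ ⟩
    suc m C 2           ≡⟨ [1+m]C2≡m+mC2 m ⟩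
    m + m C 2           ≡⟨ cong (_+_ m) (sum+sum-deficits c stair) ⟨
    m + (Σc + Σd)       ≡⟨ cong (_+_ m) (+-comm Σc Σd) ⟩
    m + (Σd + Σc)       ≡⟨ +-assoc m Σd Σc ⟨
    m + Σd + Σc         ∎)
    where open ≡-Reasoning
  head : + x ℤ.- + m ≡ + Σd
  head rewrite x≡m+Σd =
    trans (ℤₚ.m-n≡m⊖n (m + Σd) m) (trans (ℤₚ.⊖-≥ (m≤m+n m Σd)) (cong +_ (m+n∸m≡n m Σd)))

K-jMinusδ>0 : (x : ℕ) (c : Vec ℕ m) → Staircase c → x + Vec.sum c ≡ suc m C 2 →
              0 < K (suc m) (jMinusδ (suc m) (x ∷ c))
K-jMinusδ>0 {m} x c stair x+Σc≡ =
  subst (λ v → 0 < K (suc m) v) (sym (jMinusδ≡starNet x c stair x+Σc≡)) (K-starNet>0 (deficits c))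

Nvec-interior : (m t : ℕ) (i : Fin m) → Vec.lookup (Nvec (suc m) t) (Fin.suc (Fin.inject₁ i)) ≡ + 0
Nvec-interior m t i = trans (lookup∘tabulate N (Fin.suc (Fin.inject₁ i)))
  (cong (if_then ℤ.- + t else + 0) (trans (isYes≗does (suc (toℕ (Fin.inject₁ i)) ≟ suc m))
    (dec-false (suc (toℕ (Fin.inject₁ i)) ≟ suc m) λ eq →
      <-irrefl (trans (sym (toℕ-inject₁ i)) (suc-injective eq)) (toℕ<n i))))
  where
  N : Fin (suc (suc m)) → ℤ
  N k = if ⌊ toℕ k ≟ 0 ⌋ then + t else if ⌊ toℕ k ≟ suc m ⌋ then - + t else + 0

prodℤ-staircaseBinomials : (c : Vec ℕ m) →
  prodℤ (tabulate λ i → + ((m ∸ suc (toℕ i)) C Vec.lookup c i)) ≡ + stairWeight c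
prodℤ-staircaseBinomials []            = refl
prodℤ-staircaseBinomials {suc m} (y ∷ c) =
  trans (cong (+ (m C y) ℤ.*_) (prodℤ-staircaseBinomials c)) (sym (ℤₚ.pos-* (m C y) _))

weight-Nvec : (m t x : ℕ) (c : Vec ℕ m) → weight (suc m) (Nvec (suc m) t) (x ∷ c) ≡
              + (((t + m) C x) * stairWeight c * K (suc m) (jMinusδ (suc m) (x ∷ c)))
weight-Nvec m t x c = begin
  weight (suc m) (Nvec (suc m) t) (x ∷ c)
    ≡⟨ cong (λ p → (+ ((t + m) C x) ℤ.* p) ℤ.* + k)
            (trans (cong prodℤ (tabulate-cong interior)) (prodℤ-staircaseBinomials c)) ⟩
  (+ ((t + m) C x) ℤ.* + stairWeight c) ℤ.* + k ≡⟨ cong (ℤ._* + k) (ℤₚ.pos-* ((t + m) C x) _) ⟨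
  + (((t + m) C x) * stairWeight c) ℤ.* + k     ≡⟨ ℤₚ.pos-* (((t + m) C x) * stairWeight c) k ⟨
  + (((t + m) C x) * stairWeight c * k)         ∎
  where
  open ≡-Reasoning
  k = K (suc m) (jMinusδ (suc m) (x ∷ c))
  interior : ∀ i → binomℤ (Vec.lookup (Nvec (suc m) t) (Fin.suc (Fin.inject₁ i)) ℤ.+ + (m ∸ suc (toℕ i)))
                          (Vec.lookup c i)
                   ≡ + ((m ∸ suc (toℕ i)) C Vec.lookup c i)
  interior i = cong (λ N → binomℤ (N ℤ.+ + (m ∸ suc (toℕ i))) (Vec.lookup c i)) (Nvec-interior m t i)

[1+m]C2∸sum≡m+gap : (c : Vec ℕ m) → Staircase c → suc m C 2 ∸ Vec.sum c ≡ m + (m C 2 ∸ Vec.sum c)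
[1+m]C2∸sum≡m+gap {m} c stair = trans (cong (_∸ Vec.sum c) ([1+m]C2≡m+mC2 m)) (+-∸-assoc m (sum≤mC2 c stair))

-- Positivity of the weight reduces to that of its binomial factors, K_n(j − δ) > 0 being automatic.
∈S⁺⇔ : (m t x : ℕ) (c : Vec ℕ m) →
  (x + Vec.sum c ≡ suc m C 2 × + 0 ℤ.< weight (suc m) (Nvec (suc m) t) (x ∷ c))
  ⇔ (NearStaircase t c × x ≡ suc m C 2 ∸ Vec.sum c)
∈S⁺⇔ m t x c = mk⇔ into onto
  where
  s a w k : ℕ
  s = Vec.sum c
  a = (t + m) C x
  w = stairWeight c
  k = K (suc m) (jMinusδ (suc m) (x ∷ c))
  0<weight⇔ : + 0 ℤ.< weight (suc m) (Nvec (suc m) t) (x ∷ c) ⇔ ((0 < a × 0 < w) × 0 < k)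
  0<weight⇔ = mk⇔
    (λ pos → let 0<aw , 0<k = Equivalence.to (0<m*n⇔ (a * w) k)
                                (ℤₚ.drop‿+<+ (subst (+ 0 ℤ.<_) (weight-Nvec m t x c) pos))
             in Equivalence.to (0<m*n⇔ a w) 0<aw , 0<k)
    (λ (0<a,w , 0<k) → subst (+ 0 ℤ.<_) (sym (weight-Nvec m t x c))
                         (ℤ.+<+ (Equivalence.from (0<m*n⇔ (a * w) k) (Equivalence.from (0<m*n⇔ a w) 0<a,w , 0<k))))
  into : x + s ≡ suc m C 2 × + 0 ℤ.< weight (suc m) (Nvec (suc m) t) (x ∷ c) →
         NearStaircase t c × x ≡ suc m C 2 ∸ s
  into (x+s≡ , pos) = (stair , gap≤t) , x≡
    where
    0<a : 0 < a
    0<a = proj₁ (proj₁ (Equivalence.to 0<weight⇔ pos))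
    stair : Staircase c
    stair = Equivalence.to (0<stairWeight⇔ c) (proj₂ (proj₁ (Equivalence.to 0<weight⇔ pos)))
    x≡ : x ≡ suc m C 2 ∸ s
    x≡ = sym (trans (cong (_∸ s) (sym x+s≡)) (m+n∸n≡m x s))
    gap≤t : m C 2 ∸ s ≤ t
    gap≤t = +-cancelˡ-≤ m _ t
      (subst₂ _≤_ (trans x≡ ([1+m]C2∸sum≡m+gap c stair)) (+-comm t m)
                  (Equivalence.to (0<nCk⇔k≤n (t + m) x) 0<a))
  onto : NearStaircase t c × x ≡ suc m C 2 ∸ s →
         x + s ≡ suc m C 2 × + 0 ℤ.< weight (suc m) (Nvec (suc m) t) (x ∷ c)
  onto ((stair , gap≤t) , x≡) = x+s≡ , Equivalence.from 0<weight⇔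
    ( (Equivalence.from (0<nCk⇔k≤n (t + m) x) x≤t+m , Equivalence.from (0<stairWeight⇔ c) stair)
    , K-jMinusδ>0 x c stair x+s≡)
    where
    x+s≡ : x + s ≡ suc m C 2
    x+s≡ = trans (cong (_+ s) x≡) (m∸n+n≡m (≤-trans (sum≤mC2 c stair)
                   (subst (m C 2 ≤_) (sym ([1+m]C2≡m+mC2 m)) (m≤n+m _ m))))
    x≤t+m : x ≤ t + m
    x≤t+m = subst₂ _≤_ (sym (trans x≡ ([1+m]C2∸sum≡m+gap c stair))) (+-comm m t) (+-monoʳ-≤ m gap≤t)

cardSplus≡count-nearStaircase : (m t : ℕ) →
  cardSplus (suc m) (Nvec (suc m) t) ≡ count (does ∘ nearStaircase? t) (natVecs m (suc m C 2))
cardSplus≡count-nearStaircase m t = begin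
  cardSplus (suc m) (Nvec (suc m) t)
    ≡⟨ count-cong {xs = natVecs (suc m) b} (λ { {x ∷ c} _ → member≡ x c }) ⟩
  count member (natVecs (suc m) b)
    ≡⟨ count-vecsOver-suc′ member (upTo (suc b)) ⟩
  sum (map (λ c → count (λ x → member (x ∷ c)) (upTo (suc b))) (natVecs m b))
    ≡⟨ cong sum (map-cong (λ c → trans (count-∧ˡ (does (nearStaircase? t c)) _ (upTo (suc b)))
                                       (cong (if does (nearStaircase? t c) then_else 0)
                                             (count-≟-unique (upTo (suc b)) (Uniqueₚ.upTo⁺ (suc b))
                                                             (∈-upTo⁺ (s≤s (m∸n≤m b (Vec.sum c)))))))
                          (natVecs m b)) ⟩
  sum (map (indicator ∘ does ∘ nearStaircase? t) (natVecs m b))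
    ≡⟨ count≡sum (does ∘ nearStaircase? t) (natVecs m b) ⟨
  count (does ∘ nearStaircase? t) (natVecs m b) ∎
  where
  open ≡-Reasoning
  b = suc m C 2
  member : Vec ℕ (suc m) → Bool
  member (x ∷ c) = does (nearStaircase? t c) ∧ does (x ≟ b ∸ Vec.sum c)
  member≡ : ∀ x c → isWeakCompᵇ (suc m) (x ∷ c) ∧ ⌊ + 0 ℤ.<? weight (suc m) (Nvec (suc m) t) (x ∷ c) ⌋
                    ≡ member (x ∷ c)
  member≡ x c = trans (cong₂ _∧_ (isYes≗does (x + Vec.sum c ≟ b))
                                 (isYes≗does (+ 0 ℤ.<? weight (suc m) (Nvec (suc m) t) (x ∷ c))))
    (does-⇔ (∈S⁺⇔ m t x c) (x + Vec.sum c ≟ b ×-dec + 0 ℤ.<? _) (nearStaircase? t c ×-dec x ≟ b ∸ Vec.sum c))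

cardSplus-Nvec≡lehmerCount : (m t : ℕ) → cardSplus (suc m) (Nvec (suc m) t) ≡ lehmerCount m t
cardSplus-Nvec≡lehmerCount m t = trans (cardSplus≡count-nearStaircase m t)
  (count-nearStaircase m (suc m C 2) t (subst (m ≤_) (sym ([1+m]C2≡m+mC2 m)) (m≤m+n m _)))

proposition6p5 : (n : ℕ) → 2 ≤ n → (t : ℕ) →
    (cardSplus n (Nvec n t) ≡ J (n ∸ 1) t)
    × ((n ∸ 1) C 2 ≤ t → cardSplus n (Nvec n t) ≡ (n ∸ 1) !)
proposition6p5 zero    () t
proposition6p5 (suc m) _  t =
    trans (cardSplus-Nvec≡lehmerCount m t) (sym (J≡lehmerCount m t))
  , λ sat → trans (cardSplus-Nvec≡lehmerCount m t) (lehmerCount-saturated m t sat)
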